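{- Fix a sequence $\mathbf{a}=(a_k)_{k\ge1}$ with each $a_k\in\{0,1\}$. Then for every $n\ge 0$, $$\widetilde{\mathcal H}^{\mathbf{a}}_n(t)=\sum_{k=0}^n\binom{n}{k}t^k\,\widehat{\mathcal H}^{\mathbf{a}}_k(t).$$
   Context: For a finite set of variables $\mathbf{y}$ (with $|\mathbf y|=k$), let $\widetilde{\mathcal H}^{\mathbf a}_{\mathbf{y}}$ be the set of $f\in\mathbb{R}[\mathbf{y}]$ with $\widetilde D_k f=0$ for every $k\ge1$ such that $a_k=1$, where $\widetilde D_k=\sum_{y\in\mathbf y} y\,\partial_y^{k+1}$; and let $\widehat{\mathcal H}^{\mathbf a}_{\mathbf{y}}$ be the set of $f\in\mathbb{R}[\mathbf{y}]$ with $\widehat D_k f=0$ for every $k\ge1$ such that $a_k=1$, where $\widehat D_k=\sum_{y\in\mathbf y}\partial_y^{k+1}\circ y=\sum_{y\in\mathbf y} y\,\partial_y^{k+1}+(k+1)\partial_y^k$. For $\mathbf y=\emptyset$ both spaces are the scalars $\mathbb R$. These spaces are graded by degree; $\widetilde{\mathcal H}^{\mathbf a}_n(t)$ and $\widehat{\mathcal H}^{\mathbf a}_k(t)$ denote the Hilbert series $\sum_{d\ge0}t^d\dim(\text{degree- }d\text{ component})$ of these spaces for a set of $n$ (resp. $k$) variables (they depend only on the number of variables).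
   Formalization: The spaces $\widetilde{\mathcal H}^{\mathbf a}_{\mathbf{y}}$ and $\widehat{\mathcal H}^{\mathbf a}_{\mathbf{y}}$ consist of polynomials with rational coefficients instead of real ones, and the dimensions of their graded pieces are taken over ℚ. -}

module Defs where

open import Data.Nat using (ℕ; zero; suc; _≤_; _≤ᵇ_; _∸_)
open import Agda.Builtin.Nat using (_==_) renaming (_+_ to _+ℕ_; _*_ to _*ℕ_)
open import Data.Nat.Combinatorics using (_C_)
open import Data.Bool using (Bool; true; false; if_then_else_; _∧_)
open import Data.Integer using (+_)
open import Data.Rational using (ℚ; 0ℚ; _+_; _*_; _/_)
open import Data.Fin using (Fin)
open import Data.Vec using (Vec; []; _∷_; lookup; updateAt; allFin; toList)
open import Data.List using (List; []; _∷_; _++_; map; concatMap; foldr; upTo)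
open import Data.Nat.ListAction using (sum)
open import Data.Product using (_×_; _,_; Σ)
open import Data.Unit using (⊤)
open import Relation.Binary.PropositionalEquality using (_≡_; _≢_)

ℕtoℚ : ℕ → ℚ
ℕtoℚ k = + k / 1

Mono : ℕ → Set
Mono n = Vec ℕ n

deg : ∀ {n} → Mono n → ℕ
deg e = sum (toList e)

-- Polynomials in n variables with rational coefficients, as finite lists of
-- terms (coefficient, monomial); equal monomials may repeat (they add up).
Poly : ℕ → Set
Poly n = List (ℚ × Mono n)

monoEq : ∀ {n} → Mono n → Mono n → Bool
monoEq [] [] = true
monoEq (x ∷ xs) (y ∷ ys) = (x == y) ∧ monoEq xs ys

coeff : ∀ {n} → Poly n → Mono n → ℚ
coeff [] e = 0ℚ
coeff ((c , f) ∷ p) e = (if monoEq f e then c else 0ℚ) + coeff p e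

_≈P_ : ∀ {n} → Poly n → Poly n → Set
p ≈P q = ∀ e → coeff p e ≡ coeff q e

zeroP : ∀ {n} → Poly n
zeroP = []

scaleP : ∀ {n} → ℚ → Poly n → Poly n
scaleP c = map (λ { (d , e) → (c * d , e) })

fall : ℕ → ℕ → ℕ
fall m zero = 1
fall zero (suc j) = 0
fall (suc m) (suc j) = suc m *ℕ fall m j

partialPow : ∀ {n} → Fin n → ℕ → Poly n → Poly n
partialPow i j = concatMap term
  where
  term : _ → _
  term (c , e) = if j ≤ᵇ lookup e i
                 then (c * ℕtoℚ (fall (lookup e i) j) , updateAt e i (λ x → x ∸ j)) ∷ []
                 else []

mulVar : ∀ {n} → Fin n → Poly n → Poly n
mulVar i = map (λ { (c , e) → (c , updateAt e i suc) })

Dtilde : ∀ {n} → ℕ → Poly n → Poly n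
Dtilde {n} k p = concatMap (λ i → mulVar i (partialPow i (suc k) p)) (toList (allFin n))

Dhat : ∀ {n} → ℕ → Poly n → Poly n
Dhat {n} k p = concatMap (λ i → partialPow i (suc k) (mulVar i p)) (toList (allFin n))

Homog : ∀ {n} → ℕ → Poly n → Set
Homog d p = ∀ e → deg e ≢ d → coeff p e ≡ 0ℚ

-- The sequence a = (a_k)_{k ≥ 1} is given as a : ℕ → Bool with a k ≡ true meaning a_k = 1
-- (the value a 0 is irrelevant).

-- Degree-d component of H̃^a in n variables.
TildeSpace : (ℕ → Bool) → (n d : ℕ) → Poly n → Set
TildeSpace a n d p = Homog d p × (∀ k → 1 ≤ k → a k ≡ true → Dtilde k p ≈P zeroP)

-- Degree-d component of Ĥ^a in k variables.
HatSpace : (ℕ → Bool) → (n d : ℕ) → Poly n → Set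
HatSpace a n d p = Homog d p × (∀ k → 1 ≤ k → a k ≡ true → Dhat k p ≈P zeroP)

linComb : ∀ {n m} → Vec ℚ m → Vec (Poly n) m → Poly n
linComb [] [] = []
linComb (c ∷ cs) (b ∷ bs) = scaleP c b ++ linComb cs bs

AllV : ∀ {A : Set} {m} → (A → Set) → Vec A m → Set
AllV P [] = ⊤
AllV P (x ∷ xs) = P x × AllV P xs

IsDim : ∀ {n} → (Poly n → Set) → ℕ → Set
IsDim {n} V m =
  Σ (Vec (Poly n) m) λ b →
    AllV V b
    × (∀ (c : Vec ℚ m) → linComb c b ≈P zeroP → AllV (λ x → x ≡ 0ℚ) c)
    × (∀ p → V p → Σ (Vec ℚ m) λ c → p ≈P linComb c b)

-- Coefficient of t^d in Σ_{k=0}^n C(n,k) t^k Ĥ_k(t), given hatDim k = dim of the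
-- degree-(d-k) component of Ĥ^a_k (only used for k ≤ d).
rhsCoeff : (n d : ℕ) → (ℕ → ℕ) → ℕ
rhsCoeff n d hatDim =
  sum (map (λ k → if k ≤ᵇ d then (n C k) *ℕ hatDim k else 0) (upTo (suc n)))

module Submission where

-- The summand y ∂_y^{k+1} of D̃_k kills y^e unless e ≥ k + 1, and then sends it to a multiple of
-- y^{e-k}, still divisible by y. So D̃_k preserves the support of every monomial, and the degree-d
-- part of H̃ in n variables is the direct sum of its pieces of fixed support S ⊆ {1..n}. Dividing
-- by ∏_{i ∈ S} y_i identifies the piece of support S with the degree-(d - |S|) part of Ĥ in the
-- |S| variables of S, because y ∂^{k+1} y^{e+1} = y · ∂^{k+1} (y · y^e). There are C(n, k)
-- supports of size k, and the piece is zero when |S| > d.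

open import Defs
open import Algebra.Bundles using (CommutativeMonoid)
open import Data.Bool using (Bool; true; false; if_then_else_; _∧_; not)
import Data.Bool as Bool
open import Data.Fin using (Fin; zero; suc)
open import Data.Fin.Subset using (Subset; inside; outside; ∣_∣)
open import Data.Fin.Subset.Properties using (∣p∣≤n)
open import Data.List using (List; []; _∷_; _++_; [_]; map; concatMap; filterᵇ; applyUpTo; upTo)
import Data.List.Properties as List
open import Data.List.Membership.Propositional using (_∈_)
open import Data.List.Membership.Propositional.Properties using (∈-map⁺; ∈-map⁻; ∈-++⁺ˡ; ∈-++⁺ʳ)
open import Data.List.Relation.Binary.Disjoint.Propositional using (Disjoint)
import Data.List.Relation.Unary.All as All
open import Data.List.Relation.Unary.Any using (here; there)
open import Data.List.Relation.Unary.Unique.Propositional using (Unique; []; _∷_)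
import Data.List.Relation.Unary.Unique.Propositional.Properties as Unique
open import Data.Nat using (ℕ; zero; suc; _≤_; _<_; _∸_; _≤ᵇ_)
import Data.Nat as ℕ
import Data.Nat.Properties as ℕ
open import Data.Nat.Combinatorics using (_C_; nCk+nC[k+1]≡[n+1]C[k+1]; k>n⇒nCk≡0)
open import Data.Nat.ListAction using (sum)
open import Data.Nat.ListAction.Properties using (sum-++)
open import Data.Product using (_×_; _,_; Σ; proj₁; proj₂; map₂)
open import Data.Rational using (ℚ; 0ℚ; _+_; _*_)
import Data.Rational.Properties as ℚ
open import Data.Unit using (tt)
open import Data.Vec using (Vec; []; _∷_; allFin; toList)
import Data.Vec as Vec
import Data.Vec.Properties as Vec
open import Function using (_∘_; case_of_)
open import Relation.Binary.Definitions using (DecidableEquality)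
open import Relation.Binary.PropositionalEquality hiding ([_])
open import Relation.Nullary using (¬_; does; yes; no; contradiction)
open import Relation.Nullary.Decidable using (dec-true; dec-false)
open import Relation.Nullary.Reflects using (ofʸ; ofⁿ)
open import Relation.Unary using (_⊆_; _∩_)

open import Algebra.Properties.CommutativeSemigroup
  (CommutativeMonoid.commutativeSemigroup ℚ.+-0-commutativeMonoid) renaming (interchange to +-interchange)
open import Algebra.Properties.CommutativeSemigroup
  (CommutativeMonoid.commutativeSemigroup ℕ.+-0-commutativeMonoid) renaming (interchange to ℕ-interchange)

_≟ₘ_ : ∀ {n} → DecidableEquality (Mono n)
_≟ₘ_ = Vec.≡-dec ℕ._≟_

monoEq-does : ∀ {n} (e f : Mono n) → monoEq e f ≡ does (e ≟ₘ f)
monoEq-does [] [] = refl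
monoEq-does (x ∷ e) (y ∷ f) = cong (does (x ℕ.≟ y) ∧_) (monoEq-does e f)

coeff-++ : ∀ {n} (p q : Poly n) e → coeff (p ++ q) e ≡ coeff p e + coeff q e
coeff-++ [] q e = sym (ℚ.+-identityˡ _)
coeff-++ ((c , f) ∷ p) q e = trans (cong (head +_) (coeff-++ p q e)) (sym (ℚ.+-assoc head _ _))
  where head = if monoEq f e then c else 0ℚ

coeff-scaleP : ∀ {n} c (p : Poly n) e → coeff (scaleP c p) e ≡ c * coeff p e
coeff-scaleP c [] e = sym (ℚ.*-zeroʳ c)
coeff-scaleP c ((d , f) ∷ p) e with monoEq f e
... | true  = trans (cong (c * d +_) (coeff-scaleP c p e)) (sym (ℚ.*-distribˡ-+ c d _))
... | false = trans (cong (0ℚ +_) (coeff-scaleP c p e))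
                (trans (ℚ.+-identityˡ _) (cong (c *_) (sym (ℚ.+-identityˡ _))))

coeff-filterᵇ : ∀ {n} (R : Mono n → Bool) (p : Poly n) e →
  coeff (filterᵇ (R ∘ proj₂) p) e ≡ (if R e then coeff p e else 0ℚ)
coeff-filterᵇ R [] e with R e
... | true  = refl
... | false = refl
coeff-filterᵇ R ((c , f) ∷ p) e with R f in Rf
... | true rewrite coeff-filterᵇ R p e | monoEq-does f e with f ≟ₘ e
...   | yes refl rewrite Rf = refl
...   | no _ with R e
...     | true  = refl
...     | false = ℚ.+-identityˡ 0ℚ
coeff-filterᵇ R ((c , f) ∷ p) e | false rewrite coeff-filterᵇ R p e | monoEq-does f e with f ≟ₘ e
...   | yes refl rewrite Rf = refl
...   | no _ with R e
...     | true  = sym (ℚ.+-identityˡ _)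
...     | false = refl

coeff-concatMap-++ : ∀ {A : Set} {n} (X Y : A → Poly n) I g →
  coeff (concatMap (λ a → X a ++ Y a) I) g ≡ coeff (concatMap X I) g + coeff (concatMap Y I) g
coeff-concatMap-++ X Y [] g = sym (ℚ.+-identityˡ 0ℚ)
coeff-concatMap-++ X Y (a ∷ I) g = begin
  coeff ((X a ++ Y a) ++ concatMap (λ a → X a ++ Y a) I) g
    ≡⟨ coeff-++ (X a ++ Y a) _ g ⟩
  coeff (X a ++ Y a) g + coeff (concatMap (λ a → X a ++ Y a) I) g
    ≡⟨ cong₂ _+_ (coeff-++ (X a) (Y a) g) (coeff-concatMap-++ X Y I g) ⟩
  (coeff (X a) g + coeff (Y a) g) + (coeff (concatMap X I) g + coeff (concatMap Y I) g)
    ≡⟨ +-interchange (coeff (X a) g) (coeff (Y a) g) (coeff (concatMap X I) g) (coeff (concatMap Y I) g) ⟩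
  (coeff (X a) g + coeff (concatMap X I) g) + (coeff (Y a) g + coeff (concatMap Y I) g)
    ≡⟨ sym (cong₂ _+_ (coeff-++ (X a) (concatMap X I) g) (coeff-++ (Y a) (concatMap Y I) g)) ⟩
  coeff (X a ++ concatMap X I) g + coeff (Y a ++ concatMap Y I) g ∎
  where open ≡-Reasoning

renameP : ∀ {m n} → (Mono m → Mono n) → Poly m → Poly n
renameP φ = map (map₂ φ)

coeff-renameP-image : ∀ {m n} (φ : Mono m → Mono n) → (∀ {e e′} → φ e ≡ φ e′ → e ≡ e′) →
  ∀ q e → coeff (renameP φ q) (φ e) ≡ coeff q e
coeff-renameP-image φ φ-inj [] e = refl
coeff-renameP-image φ φ-inj ((c , f) ∷ q) e
  rewrite monoEq-does (φ f) (φ e) | monoEq-does f e | coeff-renameP-image φ φ-inj q e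
  with φ f ≟ₘ φ e | f ≟ₘ e
... | yes _   | yes _   = refl
... | no _    | no _    = refl
... | yes φ≡  | no f≢e  = contradiction (φ-inj φ≡) f≢e
... | no φ≢   | yes refl = contradiction refl φ≢

coeff-renameP-outside : ∀ {m n} (φ : Mono m → Mono n) q g → (∀ e → φ e ≢ g) →
  coeff (renameP φ q) g ≡ 0ℚ
coeff-renameP-outside φ [] g g∉ = refl
coeff-renameP-outside φ ((c , f) ∷ q) g g∉
  rewrite monoEq-does (φ f) g | coeff-renameP-outside φ q g g∉ with φ f ≟ₘ g
... | yes φf≡g = contradiction φf≡g (g∉ f)
... | no _     = ℚ.+-identityˡ 0ℚ

AllV-mono : ∀ {A : Set} {P Q : A → Set} {m} → P ⊆ Q → (b : Vec A m) → AllV P b → AllV Q b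
AllV-mono P⊆Q [] _ = tt
AllV-mono P⊆Q (x ∷ b) (px , pb) = P⊆Q px , AllV-mono P⊆Q b pb

AllV-map⁺ : ∀ {A B : Set} {Q : B → Set} {m} (f : A → B) (b : Vec A m) → AllV (Q ∘ f) b → AllV Q (Vec.map f b)
AllV-map⁺ f [] _ = tt
AllV-map⁺ f (x ∷ b) (qx , qb) = qx , AllV-map⁺ f b qb

AllV-++ : ∀ {A : Set} {P : A → Set} {m₁ m₂} (b₁ : Vec A m₁) (b₂ : Vec A m₂) →
  AllV P b₁ → AllV P b₂ → AllV P (b₁ Vec.++ b₂)
AllV-++ [] b₂ _ pb₂ = pb₂
AllV-++ (x ∷ b₁) b₂ (px , pb₁) pb₂ = px , AllV-++ b₁ b₂ pb₁ pb₂

linComb-++ : ∀ {n m₁ m₂} (c₁ : Vec ℚ m₁) (c₂ : Vec ℚ m₂) (b₁ : Vec (Poly n) m₁) (b₂ : Vec (Poly n) m₂) →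
  linComb (c₁ Vec.++ c₂) (b₁ Vec.++ b₂) ≡ linComb c₁ b₁ ++ linComb c₂ b₂
linComb-++ [] c₂ [] b₂ = refl
linComb-++ (x ∷ c₁) c₂ (q ∷ b₁) b₂ =
  trans (cong (scaleP x q ++_) (linComb-++ c₁ c₂ b₁ b₂)) (sym (List.++-assoc (scaleP x q) _ _))

coeff-linComb-vanishing : ∀ {n m} f (c : Vec ℚ m) (b : Vec (Poly n) m) →
  AllV (λ q → coeff q f ≡ 0ℚ) b → coeff (linComb c b) f ≡ 0ℚ
coeff-linComb-vanishing f [] [] _ = refl
coeff-linComb-vanishing f (x ∷ c) (q ∷ b) (qf≡0 , bf≡0) = begin
  coeff (scaleP x q ++ linComb c b) f       ≡⟨ coeff-++ (scaleP x q) _ f ⟩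
  coeff (scaleP x q) f + coeff (linComb c b) f ≡⟨ cong₂ _+_ (coeff-scaleP x q f) (coeff-linComb-vanishing f c b bf≡0) ⟩
  x * coeff q f + 0ℚ                         ≡⟨ cong (λ r → x * r + 0ℚ) qf≡0 ⟩
  x * 0ℚ + 0ℚ                                ≡⟨ cong (_+ 0ℚ) (ℚ.*-zeroʳ x) ⟩
  0ℚ + 0ℚ                                    ≡⟨ ℚ.+-identityˡ 0ℚ ⟩
  0ℚ ∎
  where open ≡-Reasoning

IsDim-zero : ∀ {n} {V : Poly n → Set} → (∀ {p} → V p → p ≈P zeroP) → IsDim V 0
IsDim-zero V≈0 = [] , tt , (λ { [] _ → tt }) , (λ p v → [] , V≈0 v)

IsDim-cong : ∀ {n} {V V′ : Poly n → Set} {m} → V ⊆ V′ → V′ ⊆ V → IsDim V m → IsDim V′ m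
IsDim-cong V⊆V′ V′⊆V (b , b∈V , indep , span) =
  b , AllV-mono V⊆V′ b b∈V , indep , (λ p v → span p (V′⊆V v))

record LinearIso {k n} (U : Poly k → Set) (W : Poly n → Set) : Set where
  field
    to           : Poly k → Poly n
    from         : Poly n → Poly k
    to-∈         : U ⊆ W ∘ to
    from-∈       : W ⊆ U ∘ from
    to-from      : ∀ p → W p → p ≈P to (from p)
    to-cong      : ∀ q q′ → q ≈P q′ → to q ≈P to q′
    to-injective : ∀ q → to q ≈P zeroP → q ≈P zeroP
    to-linComb   : ∀ {m} (c : Vec ℚ m) b → to (linComb c b) ≈P linComb c (Vec.map to b)

IsDim-transport : ∀ {k n} {U : Poly k → Set} {W : Poly n → Set} {m} → LinearIso U W → IsDim U m → IsDim W m
IsDim-transport iso (b , b∈U , indep , span) =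
  Vec.map to b , AllV-map⁺ to b (AllV-mono to-∈ b b∈U) ,
  (λ c lc≈0 → indep c (to-injective _ (λ f → trans (to-linComb c b f) (lc≈0 f)))) ,
  (λ p p∈W → let (c , fp≈lc) = span (from p) (from-∈ p∈W) in
    c , λ f → trans (to-from p p∈W f) (trans (to-cong _ _ fp≈lc f) (to-linComb c b f)))
  where open LinearIso iso

record MonomialSplitting {n} (V V₁ V₂ : Poly n → Set) : Set where
  field
    side     : Mono n → Bool
    V₁⊆V     : V₁ ⊆ V
    V₂⊆V     : V₂ ⊆ V
    V₁-side  : ∀ {p} → V₁ p → ∀ f → side f ≡ false → coeff p f ≡ 0ℚ
    V₂-side  : ∀ {p} → V₂ p → ∀ f → side f ≡ true → coeff p f ≡ 0ℚ
    project₁ : ∀ {p} → V p → V₁ (filterᵇ (side ∘ proj₂) p)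
    project₂ : ∀ {p} → V p → V₂ (filterᵇ (not ∘ side ∘ proj₂) p)

IsDim-split : ∀ {n} {V V₁ V₂ : Poly n → Set} {m₁ m₂} →
  MonomialSplitting V V₁ V₂ → IsDim V₁ m₁ → IsDim V₂ m₂ → IsDim V (m₁ ℕ.+ m₂)
IsDim-split {V = V} {m₁ = m₁} {m₂} split
  (b₁ , b₁∈V₁ , indep₁ , span₁) (b₂ , b₂∈V₂ , indep₂ , span₂) =
  b₁ Vec.++ b₂ , AllV-++ b₁ b₂ (AllV-mono V₁⊆V b₁ b₁∈V₁) (AllV-mono V₂⊆V b₂ b₂∈V₂) , indep , span
  where
  open MonomialSplitting split
  b₁-vanish : ∀ c f → side f ≡ false → coeff (linComb c b₁) f ≡ 0ℚ
  b₁-vanish c f off = coeff-linComb-vanishing f c b₁ (AllV-mono (λ v → V₁-side v f off) b₁ b₁∈V₁)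
  b₂-vanish : ∀ c f → side f ≡ true → coeff (linComb c b₂) f ≡ 0ℚ
  b₂-vanish c f on = coeff-linComb-vanishing f c b₂ (AllV-mono (λ v → V₂-side v f on) b₂ b₂∈V₂)
  coeff-linComb-++ : ∀ c₁ c₂ f →
    coeff (linComb (c₁ Vec.++ c₂) (b₁ Vec.++ b₂)) f ≡ coeff (linComb c₁ b₁) f + coeff (linComb c₂ b₂) f
  coeff-linComb-++ c₁ c₂ f =
    trans (cong (λ r → coeff r f) (linComb-++ c₁ c₂ b₁ b₂)) (coeff-++ (linComb c₁ b₁) _ f)

  indep : ∀ c → linComb c (b₁ Vec.++ b₂) ≈P zeroP → AllV (_≡ 0ℚ) c
  indep c lc≈0 with Vec.splitAt m₁ c
  ... | c₁ , c₂ , refl = AllV-++ c₁ c₂ (indep₁ c₁ lc₁≈0) (indep₂ c₂ lc₂≈0)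
    where
    sum≡0 : ∀ f → coeff (linComb c₁ b₁) f + coeff (linComb c₂ b₂) f ≡ 0ℚ
    sum≡0 f = trans (sym (coeff-linComb-++ c₁ c₂ f)) (lc≈0 f)
    lc₁≈0 : linComb c₁ b₁ ≈P zeroP
    lc₁≈0 f with side f in eq
    ... | true  = trans (sym (ℚ.+-identityʳ _))
                    (trans (cong (coeff (linComb c₁ b₁) f +_) (sym (b₂-vanish c₂ f eq))) (sum≡0 f))
    ... | false = b₁-vanish c₁ f eq
    lc₂≈0 : linComb c₂ b₂ ≈P zeroP
    lc₂≈0 f with side f in eq
    ... | true  = b₂-vanish c₂ f eq
    ... | false = trans (sym (ℚ.+-identityˡ _))
                    (trans (cong (_+ _) (sym (b₁-vanish c₁ f eq))) (sum≡0 f))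

  span : ∀ p → V p → Σ (Vec ℚ (m₁ ℕ.+ m₂)) λ c → p ≈P linComb c (b₁ Vec.++ b₂)
  span p p∈V with span₁ _ (project₁ p∈V) | span₂ _ (project₂ p∈V)
  ... | c₁ , p₁≈ | c₂ , p₂≈ = c₁ Vec.++ c₂ , λ f → begin
    coeff p f                                          ≡⟨ coeff-split f ⟩
    coeff (filterᵇ (side ∘ proj₂) p) f + coeff (filterᵇ (not ∘ side ∘ proj₂) p) f
                                                       ≡⟨ cong₂ _+_ (p₁≈ f) (p₂≈ f) ⟩
    coeff (linComb c₁ b₁) f + coeff (linComb c₂ b₂) f  ≡⟨ sym (coeff-linComb-++ c₁ c₂ f) ⟩
    coeff (linComb (c₁ Vec.++ c₂) (b₁ Vec.++ b₂)) f    ∎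
    where
    open ≡-Reasoning
    coeff-split : ∀ f →
      coeff p f ≡ coeff (filterᵇ (side ∘ proj₂) p) f + coeff (filterᵇ (not ∘ side ∘ proj₂) p) f
    coeff-split f rewrite coeff-filterᵇ side p f | coeff-filterᵇ (not ∘ side) p f with side f
    ... | true  = sym (ℚ.+-identityʳ _)
    ... | false = sym (ℚ.+-identityˡ _)

support : ∀ {n} → Mono n → Subset n
support [] = []
support (zero ∷ e) = outside ∷ support e
support (suc _ ∷ e) = inside ∷ support e

∣support∣≤deg : ∀ {n} (f : Mono n) → ∣ support f ∣ ≤ deg f
∣support∣≤deg [] = ℕ.z≤n
∣support∣≤deg (zero ∷ f) = ∣support∣≤deg f
∣support∣≤deg (suc x ∷ f) = ℕ.s≤s (ℕ.≤-trans (∣support∣≤deg f) (ℕ.m≤n+m (deg f) x))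

-- embed S e is the monomial (∏_{i ∈ S} y_i) · e, the variables of e placed at the positions of S.
embed : ∀ {n} (S : Subset n) → Mono ∣ S ∣ → Mono n
embed [] [] = []
embed (inside ∷ S) (x ∷ e) = suc x ∷ embed S e
embed (outside ∷ S) e = 0 ∷ embed S e

-- A left inverse of embed S; on monomials of another support it returns junk.
unembed : ∀ {n} (S : Subset n) → Mono n → Mono ∣ S ∣
unembed [] [] = []
unembed (inside ∷ S) (x ∷ f) = ℕ.pred x ∷ unembed S f
unembed (outside ∷ S) (x ∷ f) = unembed S f

support-embed : ∀ {n} (S : Subset n) e → support (embed S e) ≡ S
support-embed [] [] = refl
support-embed (inside ∷ S) (x ∷ e) = cong (inside ∷_) (support-embed S e)
support-embed (outside ∷ S) e = cong (outside ∷_) (support-embed S e)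

unembed-embed : ∀ {n} (S : Subset n) e → unembed S (embed S e) ≡ e
unembed-embed [] [] = refl
unembed-embed (inside ∷ S) (x ∷ e) = cong (x ∷_) (unembed-embed S e)
unembed-embed (outside ∷ S) e = unembed-embed S e

embed-unembed : ∀ {n} (f : Mono n) → embed (support f) (unembed (support f) f) ≡ f
embed-unembed [] = refl
embed-unembed (zero ∷ f) = cong (0 ∷_) (embed-unembed f)
embed-unembed (suc x ∷ f) = cong (suc x ∷_) (embed-unembed f)

embed-injective : ∀ {n} (S : Subset n) {e e′} → embed S e ≡ embed S e′ → e ≡ e′
embed-injective S {e} {e′} eq =
  trans (sym (unembed-embed S e)) (trans (cong (unembed S) eq) (unembed-embed S e′))

deg-embed : ∀ {n} (S : Subset n) e → deg (embed S e) ≡ deg e ℕ.+ ∣ S ∣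
deg-embed [] [] = refl
deg-embed (inside ∷ S) (x ∷ e) = begin
  suc (x ℕ.+ deg (embed S e)) ≡⟨ cong (λ m → suc (x ℕ.+ m)) (deg-embed S e) ⟩
  suc (x ℕ.+ (deg e ℕ.+ ∣ S ∣)) ≡⟨ cong suc (sym (ℕ.+-assoc x (deg e) ∣ S ∣)) ⟩
  suc (x ℕ.+ deg e ℕ.+ ∣ S ∣) ≡⟨ sym (ℕ.+-suc (x ℕ.+ deg e) ∣ S ∣) ⟩
  x ℕ.+ deg e ℕ.+ suc ∣ S ∣ ∎
  where open ≡-Reasoning
deg-embed (outside ∷ S) e = deg-embed S e

_≟ₛ_ : ∀ {n} → DecidableEquality (Subset n)
_≟ₛ_ = Vec.≡-dec Bool._≟_

bySupport : ∀ {n} → (Subset n → Bool) → Poly n → Poly n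
bySupport R = filterᵇ (R ∘ support ∘ proj₂)

coeff-bySupport : ∀ {n} (R : Subset n → Bool) p g →
  coeff (bySupport R p) g ≡ (if R (support g) then coeff p g else 0ℚ)
coeff-bySupport R = coeff-filterᵇ (R ∘ support)

isSupport : ∀ {n} → Subset n → Subset n → Bool
isSupport S T = does (T ≟ₛ S)

isSupport-sound : ∀ {n} {S T : Subset n} → isSupport S T ≡ true → T ≡ S
isSupport-sound {S = S} {T} eq with T ≟ₛ S
... | yes T≡S = T≡S

coeff-bySupport-isSupport : ∀ {n} (S : Subset n) p g → support g ≡ S →
  coeff (bySupport (isSupport S) p) g ≡ coeff p g
coeff-bySupport-isSupport S p g sg≡S
  rewrite coeff-bySupport (isSupport S) p g | dec-true (support g ≟ₛ S) sg≡S = refl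

VanishesOff : ∀ {n} → (Subset n → Set) → Poly n → Set
VanishesOff P p = ∀ f → ¬ P (support f) → coeff p f ≡ 0ℚ

Homog-bySupport : ∀ {n} d (R : Subset n → Bool) p → Homog d p → Homog d (bySupport R p)
Homog-bySupport d R p hom g deg≢d rewrite coeff-bySupport R p g with R (support g)
... | true  = hom g deg≢d
... | false = refl

liftP : ∀ {n} (S : Subset n) → Poly ∣ S ∣ → Poly n
liftP S = renameP (embed S)

restrictP : ∀ {n} (S : Subset n) → Poly n → Poly ∣ S ∣
restrictP S p = renameP (unembed S) (bySupport (isSupport S) p)

coeff-liftP-embed : ∀ {n} (S : Subset n) q e → coeff (liftP S q) (embed S e) ≡ coeff q e
coeff-liftP-embed S = coeff-renameP-image (embed S) (embed-injective S)

coeff-liftP-outside : ∀ {n} (S : Subset n) q g → support g ≢ S → coeff (liftP S q) g ≡ 0ℚ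
coeff-liftP-outside S q g g∉S = coeff-renameP-outside (embed S) q g
  (λ e e≡g → g∉S (trans (cong support (sym e≡g)) (support-embed S e)))

coeff-liftP-inside : ∀ {n} (S : Subset n) q g → support g ≡ S →
  coeff (liftP S q) g ≡ coeff q (unembed S g)
coeff-liftP-inside S q g refl =
  trans (cong (coeff (liftP S q)) (sym (embed-unembed g))) (coeff-liftP-embed S q _)

liftP-cong : ∀ {n} (S : Subset n) q q′ → q ≈P q′ → liftP S q ≈P liftP S q′
liftP-cong S q q′ q≈q′ g with support g ≟ₛ S
... | yes sg≡S = trans (coeff-liftP-inside S q g sg≡S) (trans (q≈q′ _) (sym (coeff-liftP-inside S q′ g sg≡S)))
... | no sg≢S  = trans (coeff-liftP-outside S q g sg≢S) (sym (coeff-liftP-outside S q′ g sg≢S))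

liftP-linComb : ∀ {n m} (S : Subset n) (c : Vec ℚ m) b → liftP S (linComb c b) ≡ linComb c (Vec.map (liftP S) b)
liftP-linComb S [] [] = refl
liftP-linComb S (x ∷ c) (q ∷ b) = trans (List.map-++ (map₂ (embed S)) (scaleP x q) _)
  (cong₂ _++_ (trans (sym (List.map-∘ q)) (List.map-∘ q)) (liftP-linComb S c b))

liftP-restrictP : ∀ {n} (S : Subset n) p → liftP S (restrictP S p) ≡ bySupport (isSupport S) p
liftP-restrictP S [] = refl
liftP-restrictP S ((c , f) ∷ p) with support f ≟ₛ S
... | yes refl = cong₂ (λ g → (c , g) ∷_) (embed-unembed f) (liftP-restrictP S p)
... | no _     = liftP-restrictP S p

coeff-restrictP : ∀ {n} (S : Subset n) p e → coeff (restrictP S p) e ≡ coeff p (embed S e)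
coeff-restrictP S p e = begin
  coeff (restrictP S p) e                          ≡⟨ sym (coeff-liftP-embed S (restrictP S p) e) ⟩
  coeff (liftP S (restrictP S p)) (embed S e)      ≡⟨ cong (λ r → coeff r (embed S e)) (liftP-restrictP S p) ⟩
  coeff (bySupport (isSupport S) p) (embed S e)    ≡⟨ coeff-bySupport-isSupport S p _ (support-embed S e) ⟩
  coeff p (embed S e) ∎
  where open ≡-Reasoning

liftP-restrictP-≈ : ∀ {n} (S : Subset n) p → VanishesOff (_≡ S) p → p ≈P liftP S (restrictP S p)
liftP-restrictP-≈ S p vanish g rewrite liftP-restrictP S p | coeff-bySupport (isSupport S) p g
  with support g ≟ₛ S
... | yes _   = refl
... | no sg≢S = vanish g sg≢S

Homog-liftP : ∀ {n} m (S : Subset n) q → Homog m q → Homog (m ℕ.+ ∣ S ∣) (liftP S q)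
Homog-liftP m S q hom g deg≢ with support g ≟ₛ S
... | no sg≢S = coeff-liftP-outside S q g sg≢S
... | yes refl = trans (coeff-liftP-inside (support g) q g refl) (hom _ (λ deg≡m → deg≢ (begin
  deg g                                                  ≡⟨ cong deg (sym (embed-unembed g)) ⟩
  deg (embed (support g) (unembed (support g) g))        ≡⟨ deg-embed (support g) _ ⟩
  deg (unembed (support g) g) ℕ.+ ∣ support g ∣          ≡⟨ cong (ℕ._+ ∣ support g ∣) deg≡m ⟩
  m ℕ.+ ∣ support g ∣ ∎)))
  where open ≡-Reasoning

Homog-restrictP : ∀ {n} m (S : Subset n) p → Homog (m ℕ.+ ∣ S ∣) p → Homog m (restrictP S p)
Homog-restrictP m S p hom e deg≢m = trans (coeff-restrictP S p e)
  (hom (embed S e) (λ deg≡ → deg≢m (ℕ.+-cancelʳ-≡ ∣ S ∣ (deg e) m (trans (sym (deg-embed S e)) deg≡))))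

coeff-concatMap-termwise : ∀ {A : Set} {n} (G : A → Poly n → Poly n) →
  (∀ a → G a [] ≡ []) → (∀ a t P → G a (t ∷ P) ≡ G a [ t ] ++ G a P) →
  ∀ I P g → coeff (concatMap (λ a → G a P) I) g ≡ coeff (concatMap (λ t → concatMap (λ a → G a [ t ]) I) P) g
coeff-concatMap-termwise G G-[] G-∷ I [] g = coeff-zero I
  where
  coeff-zero : ∀ I → coeff (concatMap (λ a → G a []) I) g ≡ 0ℚ
  coeff-zero [] = refl
  coeff-zero (a ∷ I) rewrite G-[] a = coeff-zero I
coeff-concatMap-termwise G G-[] G-∷ I (t ∷ P) g = begin
  coeff (concatMap (λ a → G a (t ∷ P)) I) g
    ≡⟨ cong (λ r → coeff r g) (List.concatMap-cong (λ a → G-∷ a t P) I) ⟩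
  coeff (concatMap (λ a → G a [ t ] ++ G a P) I) g
    ≡⟨ coeff-concatMap-++ _ _ I g ⟩
  coeff (Dt t) g + coeff (concatMap (λ a → G a P) I) g
    ≡⟨ cong (coeff (Dt t) g +_) (coeff-concatMap-termwise G G-[] G-∷ I P g) ⟩
  coeff (Dt t) g + coeff (concatMap Dt P) g
    ≡⟨ sym (coeff-++ (Dt t) _ g) ⟩
  coeff (concatMap Dt (t ∷ P)) g ∎
  where
  open ≡-Reasoning
  Dt : ℚ × Mono _ → Poly _
  Dt t = concatMap (λ a → G a [ t ]) I

partialPow-∷ : ∀ {n} (i : Fin n) j t P → partialPow i j (t ∷ P) ≡ partialPow i j [ t ] ++ partialPow i j P
partialPow-∷ i j t P = cong (_++ partialPow i j P) (sym (List.++-identityʳ _))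

coeff-Dtilde-termwise : ∀ {n} k (P : Poly n) g →
  coeff (Dtilde k P) g ≡ coeff (concatMap (Dtilde k ∘ [_]) P) g
coeff-Dtilde-termwise {n} k = coeff-concatMap-termwise (λ i → mulVar i ∘ partialPow i (suc k)) (λ _ → refl)
  (λ i t P → trans (cong (mulVar i) (partialPow-∷ i (suc k) t P)) (List.map-++ _ (partialPow i (suc k) [ t ]) _))
  (toList (allFin n))

coeff-Dhat-termwise : ∀ {n} k (P : Poly n) g →
  coeff (Dhat k P) g ≡ coeff (concatMap (Dhat k ∘ [_]) P) g
coeff-Dhat-termwise {n} k = coeff-concatMap-termwise (λ i → partialPow i (suc k) ∘ mulVar i) (λ _ → refl)
  (λ i t P → partialPow-∷ i (suc k) (proj₁ t , Vec.updateAt (proj₂ t) i suc) (mulVar i P))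
  (toList (allFin n))

concatMap-allFin-suc : ∀ {A : Set} {n} (G : Fin (suc n) → List A) →
  concatMap G (toList (allFin (suc n))) ≡ G zero ++ concatMap (G ∘ suc) (toList (allFin n))
concatMap-allFin-suc {n = n} G = begin
  concatMap G (toList (allFin (suc n)))
    ≡⟨ cong (concatMap G ∘ toList) (Vec.allFin-map n) ⟩
  G zero ++ concatMap G (toList (Vec.map suc (allFin n)))
    ≡⟨ cong ((G zero ++_) ∘ concatMap G) (Vec.toList-map suc (allFin n)) ⟩
  G zero ++ concatMap G (map suc (toList (allFin n)))
    ≡⟨ cong (G zero ++_) (List.concatMap-map G suc (toList (allFin n))) ⟩
  G zero ++ concatMap (G ∘ suc) (toList (allFin n)) ∎
  where open ≡-Reasoning

Dtilde-∷ : ∀ {n} k c x (E : Mono n) → Dtilde k [ (c , x ∷ E) ] ≡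
  mulVar zero (partialPow zero (suc k) [ (c , x ∷ E) ]) ++ renameP (x ∷_) (Dtilde k [ (c , E) ])
Dtilde-∷ {n} k c x E = trans (concatMap-allFin-suc (λ i → mulVar i (partialPow i (suc k) [ (c , x ∷ E) ])))
  (cong (mulVar zero (partialPow zero (suc k) [ (c , x ∷ E) ]) ++_)
  (trans (List.concatMap-cong step (toList (allFin n))) (sym (List.map-concatMap (map₂ (x ∷_)) _ (toList (allFin n))))))
  where
  step : ∀ i → mulVar (suc i) (partialPow (suc i) (suc k) [ (c , x ∷ E) ]) ≡
               renameP (x ∷_) (mulVar i (partialPow i (suc k) [ (c , E) ]))
  step i with suc k ≤ᵇ Vec.lookup E i
  ... | true  = refl
  ... | false = refl

Dhat-∷ : ∀ {n} k c x (E : Mono n) → Dhat k [ (c , x ∷ E) ] ≡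
  partialPow zero (suc k) (mulVar zero [ (c , x ∷ E) ]) ++ renameP (x ∷_) (Dhat k [ (c , E) ])
Dhat-∷ {n} k c x E = trans (concatMap-allFin-suc (λ i → partialPow i (suc k) (mulVar i [ (c , x ∷ E) ])))
  (cong (partialPow zero (suc k) (mulVar zero [ (c , x ∷ E) ]) ++_)
  (trans (List.concatMap-cong step (toList (allFin n))) (sym (List.map-concatMap (map₂ (x ∷_)) _ (toList (allFin n))))))
  where
  step : ∀ i → partialPow (suc i) (suc k) (mulVar (suc i) [ (c , x ∷ E) ]) ≡
               renameP (x ∷_) (partialPow i (suc k) (mulVar i [ (c , E) ]))
  step i with suc k ≤ᵇ Vec.lookup (Vec.updateAt E i suc) i
  ... | true  = refl
  ... | false = refl

-- The summands of a variable outside S vanish on both sides, since ∂^{k+1} kills exponent 0;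
-- for a variable in S, y ∂^{k+1} y^{x+1} = y · ∂^{k+1} (y · y^x).
Dtilde-embed : ∀ {n} k (S : Subset n) c e → Dtilde k [ (c , embed S e) ] ≡ liftP S (Dhat k [ (c , e) ])
Dtilde-embed k [] c [] = refl
Dtilde-embed k (outside ∷ S) c e = begin
  Dtilde k [ (c , 0 ∷ embed S e) ]                 ≡⟨ Dtilde-∷ k c 0 (embed S e) ⟩
  renameP (0 ∷_) (Dtilde k [ (c , embed S e) ])    ≡⟨ cong (renameP (0 ∷_)) (Dtilde-embed k S c e) ⟩
  renameP (0 ∷_) (liftP S (Dhat k [ (c , e) ]))    ≡⟨ sym (List.map-∘ (Dhat k [ (c , e) ])) ⟩
  liftP (outside ∷ S) (Dhat k [ (c , e) ]) ∎
  where open ≡-Reasoning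
Dtilde-embed k (inside ∷ S) c (x ∷ e) = begin
  Dtilde k [ (c , suc x ∷ embed S e) ]
    ≡⟨ Dtilde-∷ k c (suc x) (embed S e) ⟩
  head-tilde ++ renameP (suc x ∷_) (Dtilde k [ (c , embed S e) ])
    ≡⟨ cong₂ _++_ head-tilde≡ (cong (renameP (suc x ∷_)) (Dtilde-embed k S c e)) ⟩
  liftP (inside ∷ S) head-hat ++ renameP (suc x ∷_) (liftP S (Dhat k [ (c , e) ]))
    ≡⟨ cong (liftP (inside ∷ S) head-hat ++_)
         (trans (sym (List.map-∘ (Dhat k [ (c , e) ]))) (List.map-∘ (Dhat k [ (c , e) ]))) ⟩
  liftP (inside ∷ S) head-hat ++ liftP (inside ∷ S) (renameP (x ∷_) (Dhat k [ (c , e) ]))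
    ≡⟨ sym (List.map-++ _ head-hat _) ⟩
  liftP (inside ∷ S) (head-hat ++ renameP (x ∷_) (Dhat k [ (c , e) ]))
    ≡⟨ cong (liftP (inside ∷ S)) (sym (Dhat-∷ k c x e)) ⟩
  liftP (inside ∷ S) (Dhat k [ (c , x ∷ e) ]) ∎
  where
  open ≡-Reasoning
  head-tilde = mulVar zero (partialPow zero (suc k) [ (c , suc x ∷ embed S e) ])
  head-hat = partialPow zero (suc k) (mulVar zero [ (c , x ∷ e) ])
  head-tilde≡ : head-tilde ≡ liftP (inside ∷ S) head-hat
  head-tilde≡ with suc k ≤ᵇ suc x
  ... | true  = refl
  ... | false = refl

Dtilde-term : ∀ {n} k c (f : Mono n) →
  Dtilde k [ (c , f) ] ≡ liftP (support f) (Dhat k [ (c , unembed (support f) f) ])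
Dtilde-term k c f = trans (cong (λ g → Dtilde k [ (c , g) ]) (sym (embed-unembed f)))
  (Dtilde-embed k (support f) c (unembed (support f) f))

coeff-Dtilde-term-outside : ∀ {n} k c (f g : Mono n) → support g ≢ support f →
  coeff (Dtilde k [ (c , f) ]) g ≡ 0ℚ
coeff-Dtilde-term-outside k c f g sg≢sf rewrite Dtilde-term k c f =
  coeff-liftP-outside (support f) (Dhat k [ (c , unembed (support f) f) ]) g sg≢sf

coeff-Dtilde-bySupport : ∀ {n} k (R : Subset n → Bool) p g →
  coeff (Dtilde k (bySupport R p)) g ≡ (if R (support g) then coeff (Dtilde k p) g else 0ℚ)
coeff-Dtilde-bySupport k R p g = begin
  coeff (Dtilde k (bySupport R p)) g                       ≡⟨ coeff-Dtilde-termwise k (bySupport R p) g ⟩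
  coeff (concatMap D (bySupport R p)) g                    ≡⟨ termwise p ⟩
  (if R (support g) then coeff (concatMap D p) g else 0ℚ)
    ≡⟨ cong (if R (support g) then_else 0ℚ) (sym (coeff-Dtilde-termwise k p g)) ⟩
  (if R (support g) then coeff (Dtilde k p) g else 0ℚ)     ∎
  where
  open ≡-Reasoning
  D = Dtilde k ∘ [_]
  separated : ∀ {f} b → R (support f) ≡ b → R (support g) ≡ not b → support g ≢ support f
  separated true  Rf Rg eq with () ← trans (sym Rg) (trans (cong R eq) Rf)
  separated false Rf Rg eq with () ← trans (sym Rg) (trans (cong R eq) Rf)
  termwise : ∀ p → coeff (concatMap D (bySupport R p)) g ≡ (if R (support g) then coeff (concatMap D p) g else 0ℚ)
  termwise [] with R (support g)
  ... | true  = refl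
  ... | false = refl
  termwise ((c , f) ∷ p) with R (support f) in Rf | R (support g) in Rg | termwise p
  ... | true  | true  | ih = trans (coeff-++ (D (c , f)) _ g)
          (trans (cong (coeff (D (c , f)) g +_) ih) (sym (coeff-++ (D (c , f)) (concatMap D p) g)))
  ... | false | false | ih = ih
  ... | true  | false | ih = trans (coeff-++ (D (c , f)) _ g) (trans (cong₂ _+_
          (coeff-Dtilde-term-outside k c f g (separated true Rf Rg)) ih) (ℚ.+-identityˡ 0ℚ))
  ... | false | true  | ih = sym (trans (coeff-++ (D (c , f)) _ g) (trans (cong₂ _+_
          (coeff-Dtilde-term-outside k c f g (separated false Rf Rg)) (sym ih)) (ℚ.+-identityˡ _)))

Dtilde-kernel-bySupport : ∀ {n} k (R : Subset n → Bool) p → Dtilde k p ≈P zeroP → Dtilde k (bySupport R p) ≈P zeroP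
Dtilde-kernel-bySupport k R p D≈0 g rewrite coeff-Dtilde-bySupport k R p g with R (support g)
... | true  = D≈0 g
... | false = refl

Dtilde-liftP : ∀ {n} k (S : Subset n) q → Dtilde k (liftP S q) ≈P liftP S (Dhat k q)
Dtilde-liftP k S q g = begin
  coeff (Dtilde k (liftP S q)) g                          ≡⟨ coeff-Dtilde-termwise k (liftP S q) g ⟩
  coeff (concatMap (Dtilde k ∘ [_]) (liftP S q)) g        ≡⟨ cong (λ r → coeff r g) lift-termwise ⟩
  coeff (liftP S (concatMap (Dhat k ∘ [_]) q)) g
    ≡⟨ liftP-cong S (concatMap (Dhat k ∘ [_]) q) (Dhat k q) (λ e → sym (coeff-Dhat-termwise k q e)) g ⟩
  coeff (liftP S (Dhat k q)) g ∎
  where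
  open ≡-Reasoning
  lift-termwise : concatMap (Dtilde k ∘ [_]) (liftP S q) ≡ liftP S (concatMap (Dhat k ∘ [_]) q)
  lift-termwise = begin
    concatMap (Dtilde k ∘ [_]) (liftP S q)         ≡⟨ List.concatMap-map (Dtilde k ∘ [_]) (map₂ (embed S)) q ⟩
    concatMap (Dtilde k ∘ [_] ∘ map₂ (embed S)) q  ≡⟨ List.concatMap-cong (λ (c , e) → Dtilde-embed k S c e) q ⟩
    concatMap (liftP S ∘ Dhat k ∘ [_]) q           ≡⟨ sym (List.map-concatMap (map₂ (embed S)) (Dhat k ∘ [_]) q) ⟩
    liftP S (concatMap (Dhat k ∘ [_]) q) ∎

Dhat-restrictP : ∀ {n} k (S : Subset n) p e → coeff (Dhat k (restrictP S p)) e ≡ coeff (Dtilde k p) (embed S e)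
Dhat-restrictP k S p e = begin
  coeff (Dhat k (restrictP S p)) e
    ≡⟨ sym (coeff-liftP-embed S (Dhat k (restrictP S p)) e) ⟩
  coeff (liftP S (Dhat k (restrictP S p))) (embed S e)
    ≡⟨ sym (Dtilde-liftP k S (restrictP S p) (embed S e)) ⟩
  coeff (Dtilde k (liftP S (restrictP S p))) (embed S e)
    ≡⟨ cong (λ r → coeff (Dtilde k r) (embed S e)) (liftP-restrictP S p) ⟩
  coeff (Dtilde k (bySupport (isSupport S) p)) (embed S e)
    ≡⟨ coeff-Dtilde-bySupport k (isSupport S) p (embed S e) ⟩
  (if isSupport S (support (embed S e)) then coeff (Dtilde k p) (embed S e) else 0ℚ)
    ≡⟨ cong (if_then coeff (Dtilde k p) (embed S e) else 0ℚ) (dec-true (support (embed S e) ≟ₛ S) (support-embed S e)) ⟩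
  coeff (Dtilde k p) (embed S e) ∎
  where open ≡-Reasoning

subsets : ∀ n → List (Subset n)
subsets zero = [ [] ]
subsets (suc n) = map (outside ∷_) (subsets n) ++ map (inside ∷_) (subsets n)

∈-subsets : ∀ {n} (S : Subset n) → S ∈ subsets n
∈-subsets [] = here refl
∈-subsets (outside ∷ S) = ∈-++⁺ˡ (∈-map⁺ (outside ∷_) (∈-subsets S))
∈-subsets (inside ∷ S) = ∈-++⁺ʳ (map (outside ∷_) (subsets _)) (∈-map⁺ (inside ∷_) (∈-subsets S))

subsets-unique : ∀ n → Unique (subsets n)
subsets-unique zero = All.[] ∷ []
subsets-unique (suc n) = Unique.++⁺ (Unique.map⁺ Vec.∷-injectiveʳ (subsets-unique n))
  (Unique.map⁺ Vec.∷-injectiveʳ (subsets-unique n)) outside≢inside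
  where
  outside≢inside : Disjoint (map (outside ∷_) (subsets n)) (map (inside ∷_) (subsets n))
  outside≢inside (S∈outside , S∈inside) with ∈-map⁻ (outside ∷_) S∈outside | ∈-map⁻ (inside ∷_) S∈inside
  ... | _ , _ , refl | _ , _ , ()

applyUpTo-cong : ∀ {A : Set} {f h : ℕ → A} → (∀ k → f k ≡ h k) → ∀ m → applyUpTo f m ≡ applyUpTo h m
applyUpTo-cong {f = f} {h} f≗h m =
  trans (sym (List.map-upTo f m)) (trans (List.map-cong f≗h (upTo m)) (List.map-upTo h m))

sum-applyUpTo-+ : ∀ (f h : ℕ → ℕ) m →
  sum (applyUpTo (λ k → f k ℕ.+ h k) m) ≡ sum (applyUpTo f m) ℕ.+ sum (applyUpTo h m)
sum-applyUpTo-+ f h zero = refl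
sum-applyUpTo-+ f h (suc m) = trans (cong (f 0 ℕ.+ h 0 ℕ.+_) (sum-applyUpTo-+ (f ∘ suc) (h ∘ suc) m))
  (ℕ-interchange (f 0) (h 0) _ _)

-- Summing over any range m > n lets the induction shift ranges freely: C(n, k) = 0 for k > n.
sum-subsets : ∀ n {m} → n < m → ∀ (g : ℕ → ℕ) →
  sum (map (g ∘ ∣_∣) (subsets n)) ≡ sum (applyUpTo (λ k → (n C k) ℕ.* g k) m)
sum-subsets zero {suc m} _ g = cong₂ ℕ._+_ (sym (ℕ.*-identityˡ (g 0))) (sym (C0[k+1]-vanish (g ∘ suc) m))
  where
  C0[k+1]-vanish : ∀ h m → sum (applyUpTo (λ k → (0 C suc k) ℕ.* h k) m) ≡ 0
  C0[k+1]-vanish h zero = refl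
  C0[k+1]-vanish h (suc m) = cong₂ ℕ._+_ (cong (ℕ._* h 0) (k>n⇒nCk≡0 (ℕ.z<s {0}))) (C0[k+1]-vanish (h ∘ suc) m)
sum-subsets (suc n) {suc m} (ℕ.s≤s n<m) g = begin
  sum (map (g ∘ ∣_∣) (map (outside ∷_) (subsets n) ++ map (inside ∷_) (subsets n)))
    ≡⟨ cong sum (List.map-++ (g ∘ ∣_∣) (map (outside ∷_) (subsets n)) _) ⟩
  sum (map (g ∘ ∣_∣) (map (outside ∷_) (subsets n)) ++ map (g ∘ ∣_∣) (map (inside ∷_) (subsets n)))
    ≡⟨ sum-++ (map (g ∘ ∣_∣) (map (outside ∷_) (subsets n))) _ ⟩
  sum (map (g ∘ ∣_∣) (map (outside ∷_) (subsets n))) ℕ.+ sum (map (g ∘ ∣_∣) (map (inside ∷_) (subsets n)))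
    ≡⟨ cong₂ ℕ._+_ (cong sum (sym (List.map-∘ (subsets n)))) (cong sum (sym (List.map-∘ (subsets n)))) ⟩
  sum (map (g ∘ ∣_∣) (subsets n)) ℕ.+ sum (map (g ∘ suc ∘ ∣_∣) (subsets n))
    ≡⟨ cong₂ ℕ._+_ (sum-subsets n (ℕ.m<n⇒m<1+n n<m) g) (sum-subsets n n<m (g ∘ suc)) ⟩
  ((n C 0) ℕ.* g 0 ℕ.+ B) ℕ.+ A
    ≡⟨ ℕ.+-assoc ((n C 0) ℕ.* g 0) B A ⟩
  (n C 0) ℕ.* g 0 ℕ.+ (B ℕ.+ A)
    ≡⟨ cong ((n C 0) ℕ.* g 0 ℕ.+_) (trans (ℕ.+-comm B A) (sym (sum-applyUpTo-+ _ _ m))) ⟩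
  (n C 0) ℕ.* g 0 ℕ.+ sum (applyUpTo (λ k → (n C k) ℕ.* g (suc k) ℕ.+ (n C suc k) ℕ.* g (suc k)) m)
    ≡⟨ cong ((n C 0) ℕ.* g 0 ℕ.+_) (cong sum (applyUpTo-cong pascal m)) ⟩
  (suc n C 0) ℕ.* g 0 ℕ.+ sum (applyUpTo (λ k → (suc n C suc k) ℕ.* g (suc k)) m) ∎
  where
  open ≡-Reasoning
  A = sum (applyUpTo (λ k → (n C k) ℕ.* g (suc k)) m)
  B = sum (applyUpTo (λ k → (n C suc k) ℕ.* g (suc k)) m)
  pascal : ∀ k → (n C k) ℕ.* g (suc k) ℕ.+ (n C suc k) ℕ.* g (suc k) ≡ (suc n C suc k) ℕ.* g (suc k)
  pascal k = trans (sym (ℕ.*-distribʳ-+ (g (suc k)) (n C k) (n C suc k)))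
    (cong (ℕ._* g (suc k)) (nCk+nC[k+1]≡[n+1]C[k+1] n k))

module _ (a : ℕ → Bool) (n d : ℕ) where

  TildeOn : (Subset n → Set) → Poly n → Set
  TildeOn P = TildeSpace a n d ∩ VanishesOff P

  TildeSpace-bySupport : ∀ (R : Subset n → Bool) p → TildeSpace a n d p → TildeSpace a n d (bySupport R p)
  TildeSpace-bySupport R p (hom , D≈0) =
    Homog-bySupport d R p hom , λ k k≥1 aₖ → Dtilde-kernel-bySupport k R p (D≈0 k k≥1 aₖ)

  liftP-LinearIso : ∀ S → ∣ S ∣ ≤ d → LinearIso (HatSpace a ∣ S ∣ (d ∸ ∣ S ∣)) (TildeOn (_≡ S))
  liftP-LinearIso S ∣S∣≤d = record
    { to           = liftP S
    ; from         = restrictP S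
    ; to-∈         = λ { {q} (hom , D≈0) →
                         (subst (λ m → Homog m (liftP S q)) d∸∣S∣+∣S∣≡d (Homog-liftP (d ∸ ∣ S ∣) S q hom) ,
                          λ k k≥1 aₖ → Dtilde-liftP-kernel k q (D≈0 k k≥1 aₖ)) ,
                         λ g sg≢S → coeff-liftP-outside S q g sg≢S }
    ; from-∈       = λ { {p} ((hom , D≈0) , _) →
                         Homog-restrictP (d ∸ ∣ S ∣) S p (subst (λ m → Homog m p) (sym d∸∣S∣+∣S∣≡d) hom) ,
                         λ k k≥1 aₖ e → trans (Dhat-restrictP k S p e) (D≈0 k k≥1 aₖ (embed S e)) }
    ; to-from      = λ p p∈W → liftP-restrictP-≈ S p (proj₂ p∈W)
    ; to-cong      = liftP-cong S
    ; to-injective = λ q lift≈0 e → trans (sym (coeff-liftP-embed S q e)) (lift≈0 (embed S e))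
    ; to-linComb   = λ c b g → cong (λ r → coeff r g) (liftP-linComb S c b)
    }
    where
    d∸∣S∣+∣S∣≡d : d ∸ ∣ S ∣ ℕ.+ ∣ S ∣ ≡ d
    d∸∣S∣+∣S∣≡d = ℕ.m∸n+n≡m ∣S∣≤d
    Dtilde-liftP-kernel : ∀ k q → Dhat k q ≈P zeroP → Dtilde k (liftP S q) ≈P zeroP
    Dtilde-liftP-kernel k q D≈0 g = trans (Dtilde-liftP k S q g) (liftP-cong S (Dhat k q) zeroP D≈0 g)

  TildeOn-≡-trivial : ∀ S → d < ∣ S ∣ → IsDim (TildeOn (_≡ S)) 0
  TildeOn-≡-trivial S d<∣S∣ = IsDim-zero λ { ((hom , _) , vanish) f → case support f ≟ₛ S of λ where
    (no sf≢S)  → vanish f sf≢S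
    (yes refl) → hom f λ deg≡d → ℕ.<⇒≱ d<∣S∣ (subst (∣ support f ∣ ≤_) deg≡d (∣support∣≤deg f)) }

  TildeOn-split : ∀ S L → ¬ S ∈ L → MonomialSplitting (TildeOn (_∈ S ∷ L)) (TildeOn (_≡ S)) (TildeOn (_∈ L))
  TildeOn-split S L S∉L = record
    { side     = isSupport S ∘ support
    ; V₁⊆V     = λ (t , vanish) → t , λ f sf∉ → vanish f (sf∉ ∘ here)
    ; V₂⊆V     = λ (t , vanish) → t , λ f sf∉ → vanish f (sf∉ ∘ there)
    ; V₁-side  = λ (_ , vanish) f off → vanish f λ sf≡S → case trans (sym (dec-true (_ ≟ₛ S) sf≡S)) off of λ ()
    ; V₂-side  = λ (_ , vanish) f on → vanish f λ sf∈L → S∉L (subst (_∈ L) (isSupport-sound on) sf∈L)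
    ; project₁ = λ {p} (t , _) → TildeSpace-bySupport (isSupport S) p t ,
                   λ f sf≢S → trans (coeff-bySupport (isSupport S) p f)
                                (cong (if_then coeff p f else 0ℚ) (dec-false (support f ≟ₛ S) sf≢S))
    ; project₂ = λ {p} (t , vanish) → TildeSpace-bySupport (not ∘ isSupport S) p t , rest-vanish p vanish
    }
    where
    rest-vanish : ∀ p → VanishesOff (_∈ S ∷ L) p → VanishesOff (_∈ L) (bySupport (not ∘ isSupport S) p)
    rest-vanish p vanish f sf∉L rewrite coeff-bySupport (not ∘ isSupport S) p f with support f ≟ₛ S
    ... | yes _   = refl
    ... | no sf≢S = vanish f λ { (here sf≡S) → sf≢S sf≡S ; (there sf∈L) → sf∉L sf∈L }

  pieceDim : (ℕ → ℕ) → ℕ → ℕ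
  pieceDim hatDim k = if k ≤ᵇ d then hatDim k else 0

  module _ (hatDim : ℕ → ℕ) (hyp : ∀ k → k ≤ n → k ≤ d → IsDim (HatSpace a k (d ∸ k)) (hatDim k)) where

    IsDim-TildeOn-≡ : ∀ S → IsDim (TildeOn (_≡ S)) (pieceDim hatDim ∣ S ∣)
    IsDim-TildeOn-≡ S with ∣ S ∣ ≤ᵇ d | ℕ.≤ᵇ-reflects-≤ ∣ S ∣ d
    ... | true  | ofʸ ∣S∣≤d = IsDim-transport (liftP-LinearIso S ∣S∣≤d) (hyp ∣ S ∣ (∣p∣≤n S) ∣S∣≤d)
    ... | false | ofⁿ ∣S∣≰d = TildeOn-≡-trivial S (ℕ.≰⇒> ∣S∣≰d)

    IsDim-TildeOn-∈ : ∀ L → Unique L → IsDim (TildeOn (_∈ L)) (sum (map (pieceDim hatDim ∘ ∣_∣) L))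
    IsDim-TildeOn-∈ [] _ = IsDim-zero λ (_ , vanish) f → vanish f λ ()
    IsDim-TildeOn-∈ (S ∷ L) S∷L-unique@(_ ∷ L-unique) = IsDim-split
      (TildeOn-split S L (Unique.Unique[x∷xs]⇒x∉xs S∷L-unique)) (IsDim-TildeOn-≡ S) (IsDim-TildeOn-∈ L L-unique)

  sum-pieceDim : ∀ hatDim → sum (map (pieceDim hatDim ∘ ∣_∣) (subsets n)) ≡ rhsCoeff n d hatDim
  sum-pieceDim hatDim = begin
    sum (map (pieceDim hatDim ∘ ∣_∣) (subsets n))
      ≡⟨ sum-subsets n (ℕ.n<1+n n) (pieceDim hatDim) ⟩
    sum (applyUpTo (λ k → (n C k) ℕ.* pieceDim hatDim k) (suc n))
      ≡⟨ cong sum (sym (List.map-upTo _ (suc n))) ⟩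
    sum (map (λ k → (n C k) ℕ.* pieceDim hatDim k) (upTo (suc n)))
      ≡⟨ cong sum (List.map-cong truncate (upTo (suc n))) ⟩
    rhsCoeff n d hatDim ∎
    where
    open ≡-Reasoning
    truncate : ∀ k → (n C k) ℕ.* pieceDim hatDim k ≡ (if k ≤ᵇ d then (n C k) ℕ.* hatDim k else 0)
    truncate k with k ≤ᵇ d
    ... | true  = refl
    ... | false = ℕ.*-zeroʳ (n C k)

mainTheorem3 : (a : ℕ → Bool) (n d : ℕ) (hatDim : ℕ → ℕ) →
    (∀ k → k ≤ n → k ≤ d → IsDim (HatSpace a k (d ∸ k)) (hatDim k)) →
    IsDim (TildeSpace a n d) (rhsCoeff n d hatDim)
mainTheorem3 a n d hatDim hyp = subst (IsDim (TildeSpace a n d)) (sum-pieceDim a n d hatDim)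
  (IsDim-cong proj₁ (λ t → t , λ f sf∉ → contradiction (∈-subsets (support f)) sf∉)
    (IsDim-TildeOn-∈ a n d hatDim hyp (subsets n) (subsets-unique n)))
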